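{- Let $n\geq 4$ and $1\leq k\leq \left\lfloor\frac{n-2}{2}\right\rfloor$, and let $J=\{1,2,\dots,k\}\subseteq\mathbb{Z}_n$. Then $dib(\overrightarrow{C}_n(J))=k+1$.
   Context: For $n\geq 3$ and a nonempty $J\subseteq\mathbb{Z}_n\setminus\{0\}$ with $|\{ -j,j\}\cap J|=1$ for every $j\in J$, the circulant digraph $\overrightarrow{C}_n(J)$ has vertex set $\mathbb{Z}_n$ and darts $(i,j)$ for all $i,j\in\mathbb{Z}_n$ with $j-i\in J$. A coloring of a digraph with $k$ colors is a surjective map $\varsigma:V\to\{1,\dots,k\}$; it is acyclic if each color class induces a subdigraph with no directed cycle. With respect to $\varsigma$, a vertex $u$ is a $b^+$-vertex if for every color $j\neq\varsigma(u)$ there is a dart $uw$ with $\varsigma(w)=j$, and a $b^-$-vertex if for every color $j\neq \varsigma(u)$ there is a dart $wu$ with $\varsigma(w)=j$. A $b$-coloring is a coloring in which every color class contains a $b^+$-vertex and a $b^-$-vertex. The dib-chromatic number $dib(D)$ is the largest $k$ such that $D$ admits an acyclic $b$-coloring with $k$ colors. -}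

module Defs where

open import Level using (0ℓ)
open import Data.Nat using (ℕ; zero; suc; _≤_; _%_; _+_; NonZero)
open import Data.Fin using (Fin; toℕ; inject₁; fromℕ) renaming (zero to fzero; suc to fsuc)
open import Data.Product using (Σ; ∃; _×_; ∃-syntax)
open import Data.Empty using (⊥)
open import Relation.Nullary using (¬_)
open import Relation.Binary.PropositionalEquality using (_≡_; _≢_)
open import Function.Definitions using (Injective; Surjective)

record Digraph : Set₁ where
  field
    size : ℕ
    Dart : Fin size → Fin size → Set

open Digraph public

-- Circulant digraph C⃗_n(J), with J given as a predicate on ℤ_n = Fin n.
-- Dart (i , j) iff j - i ∈ J, i.e. there is d ∈ J with i + d ≡ j (mod n).
circulant : (n : ℕ) → .{{NonZero n}} → (Fin n → Set) → Digraph
circulant n J = record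
  { size = n
  ; Dart = λ i j → ∃[ d ] (J d × ((toℕ i + toℕ d) % n ≡ toℕ j)) }

interval : (n k : ℕ) → Fin n → Set
interval n k d = (1 ≤ toℕ d) × (toℕ d ≤ k)

module _ (D : Digraph) where
  private
    V = Fin (size D)

  -- A coloring with m colors: a surjective map V → Fin m (colors 1..m ↦ Fin m).
  IsColoring : (m : ℕ) → (V → Fin m) → Set
  IsColoring m ς = Surjective _≡_ _≡_ ς

  MonoCycle : {m : ℕ} → (V → Fin m) → Fin m → Set
  MonoCycle ς c =
    ∃[ l ] Σ (Fin (suc l) → V) λ f →
      Injective _≡_ _≡_ f
      × (∀ i → ς (f i) ≡ c)
      × (∀ (i : Fin l) → Dart D (f (inject₁ i)) (f (fsuc i)))
      × Dart D (f (fromℕ l)) (f fzero)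

  IsAcyclic : {m : ℕ} → (V → Fin m) → Set
  IsAcyclic ς = ∀ c → ¬ MonoCycle ς c

  IsB⁺ : {m : ℕ} → (V → Fin m) → V → Set
  IsB⁺ ς u = ∀ j → j ≢ ς u → ∃[ w ] (Dart D u w × ς w ≡ j)

  IsB⁻ : {m : ℕ} → (V → Fin m) → V → Set
  IsB⁻ ς u = ∀ j → j ≢ ς u → ∃[ w ] (Dart D w u × ς w ≡ j)

  IsBColoring : (m : ℕ) → (V → Fin m) → Set
  IsBColoring m ς =
    IsColoring m ς
    × (∀ c → ∃[ u ] (ς u ≡ c × IsB⁺ ς u))
    × (∀ c → ∃[ u ] (ς u ≡ c × IsB⁻ ς u))

  HasAcyclicBColoring : ℕ → Set
  HasAcyclicBColoring m = ∃[ ς ] (IsBColoring m ς × IsAcyclic ς)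

  DibIs : ℕ → Set
  DibIs m = HasAcyclicBColoring m × (∀ m' → HasAcyclicBColoring m' → m' ≤ m)

-- Upper bound: a b⁺-vertex has only k out-neighbours, yet must see every other color on one of them.
-- Lower bound: color vertex i ≤ k and vertex k+1+i by i, and all further vertices by k. Vertex a
-- is then a b⁺-vertex and vertex k+1+a a b⁻-vertex of color a. As n ≥ 2k+2, a dart wrapping
-- around 0 ends at some j < k, of color j, and starts beyond k+1+j, at a color > j; so within a
-- color class every dart increases the vertex number, and no class contains a cycle.
module Submission where

open import Defs
open import Data.Nat
  using (ℕ; zero; suc; _+_; _*_; _∸_; _/_; _%_; _⊓_; _≤_; _<_; z≤n; s≤s; _≤?_; _<?_; NonZero)
open import Data.Nat.Properties
open import Data.Nat.DivMod using (m<n⇒m%n≡m; [m+n]%n≡m%n; m/n*n≤m)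
open import Data.Nat.Tactic.RingSolver using (solve-∀)
open import Data.Fin using (Fin; toℕ; fromℕ<; inject₁; fromℕ; punchIn)
  renaming (zero to fzero; suc to fsuc)
open import Data.Fin.Properties
  using (toℕ-fromℕ<; toℕ-injective; toℕ<n; toℕ≤pred[n]; punchIn-injective; punchInᵢ≢i; injective⇒≤)
open import Data.Product using (∃-syntax; _×_; _,_; proj₁; proj₂)
open import Data.Sum using (_⊎_; inj₁; inj₂)
open import Function using (_∘_)
open import Function.Definitions using (Injective)
open import Relation.Nullary using (yes; no; contradiction)
open import Relation.Binary.PropositionalEquality
  using (_≡_; refl; sym; trans; cong; cong₂; subst; module ≡-Reasoning)
open import Relation.Binary.Definitions using (tri<; tri≈; tri>)

increasing-path⇒first≤last : ∀ l (f : Fin (suc l) → ℕ) →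
  (∀ (i : Fin l) → f (inject₁ i) < f (fsuc i)) → f fzero ≤ f (fromℕ l)
increasing-path⇒first≤last zero    f increasing = ≤-refl
increasing-path⇒first≤last (suc l) f increasing =
  ≤-trans (increasing-path⇒first≤last l (f ∘ inject₁) (increasing ∘ inject₁))
          (<⇒≤ (increasing (fromℕ l)))

monochromatic-darts-increase⇒acyclic : ∀ (D : Digraph) {m} (ς : Fin (size D) → Fin m) →
  (∀ {u w} → ς u ≡ ς w → Dart D u w → toℕ u < toℕ w) → IsAcyclic D ς
monochromatic-darts-increase⇒acyclic D ς increase c (l , f , _ , color-c , path , closing) =
  <⇒≱ (increase (same-color _ _) closing)
      (increasing-path⇒first≤last l (toℕ ∘ f) (λ i → increase (same-color _ _) (path i)))
  where
    same-color : ∀ i j → ς (f i) ≡ ς (f j)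
    same-color i j = trans (color-c i) (sym (color-c j))

record OutDegree≤ (D : Digraph) (k : ℕ) : Set where
  field
    label : ∀ {u w} → Dart D u w → Fin k
    label-injective : ∀ {u w w′} (p : Dart D u w) (q : Dart D u w′) → label p ≡ label q → w ≡ w′

module _ {D : Digraph} {k : ℕ} (deg : OutDegree≤ D k) where
  open OutDegree≤ deg

  b⁺⇒colors≤outdegree : ∀ {m} (ς : Fin (size D) → Fin (suc m)) {u} → IsB⁺ D ς u → m ≤ k
  b⁺⇒colors≤outdegree {m} ς {u} b⁺ = injective⇒≤ label-of-color-injective
    where
      neighbour : (i : Fin m) → ∃[ w ] (Dart D u w × ς w ≡ punchIn (ς u) i)
      neighbour i = b⁺ (punchIn (ς u) i) (punchInᵢ≢i (ς u) i)

      label-of-color : Fin m → Fin k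
      label-of-color i = label (proj₁ (proj₂ (neighbour i)))

      label-of-color-injective : Injective _≡_ _≡_ label-of-color
      label-of-color-injective {i} {j} same-label = punchIn-injective (ς u) i j (begin
        punchIn (ς u) i          ≡⟨ sym (proj₂ (proj₂ (neighbour i))) ⟩
        ς (proj₁ (neighbour i))  ≡⟨ cong ς (label-injective _ _ same-label) ⟩
        ς (proj₁ (neighbour j))  ≡⟨ proj₂ (proj₂ (neighbour j)) ⟩
        punchIn (ς u) j          ∎)
        where open ≡-Reasoning

  bColoring⇒colors≤1+outdegree : ∀ {m ς} → IsBColoring D m ς → m ≤ suc k
  bColoring⇒colors≤1+outdegree {zero}      _                 = z≤n
  bColoring⇒colors≤1+outdegree {suc m} {ς} (_ , b⁺-vertex , _) =
    s≤s (b⁺⇒colors≤outdegree ς (proj₂ (proj₂ (b⁺-vertex fzero))))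

[m+n]%o≡p⇒m+n≡p⊎m+n≡p+o : ∀ {m n o p} .{{_ : NonZero o}} → m < o → n < o →
  (m + n) % o ≡ p → m + n ≡ p ⊎ m + n ≡ p + o
[m+n]%o≡p⇒m+n≡p⊎m+n≡p+o {m} {n} {o} {p} m<o n<o [m+n]%o≡p with m + n <? o
... | yes m+n<o = inj₁ (trans (sym (m<n⇒m%n≡m m+n<o)) [m+n]%o≡p)
... | no  m+n≮o = inj₂ (trans (sym t+o≡m+n) (cong (_+ o) t≡p))
  where
    open ≡-Reasoning
    t = m + n ∸ o
    t+o≡m+n : t + o ≡ m + n
    t+o≡m+n = m∸n+n≡m (≮⇒≥ m+n≮o)
    t<o : t < o
    t<o = +-cancelʳ-< o t o (subst (_< o + o) (sym t+o≡m+n) (+-mono-< m<o n<o))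
    t≡p : t ≡ p
    t≡p = begin
      t            ≡⟨ sym (m<n⇒m%n≡m t<o) ⟩
      t % o        ≡⟨ sym ([m+n]%n≡m%n t o) ⟩
      (t + o) % o  ≡⟨ cong (_% o) t+o≡m+n ⟩
      (m + n) % o  ≡⟨ [m+n]%o≡p ⟩
      p            ∎

module _ {n : ℕ} .{{_ : NonZero n}} {J : Fin n → Set} where

  circulant-dart : ∀ {u w} d → J d → toℕ u + toℕ d ≡ toℕ w → Dart (circulant n J) u w
  circulant-dart {u} {w} d d∈J u+d≡w =
    d , d∈J , trans (cong (_% n) u+d≡w) (m<n⇒m%n≡m (toℕ<n w))

  circulant-dart-offset : ∀ {u w} → Dart (circulant n J) u w →
    ∃[ d ] (J d × (toℕ u + toℕ d ≡ toℕ w ⊎ toℕ u + toℕ d ≡ toℕ w + n))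
  circulant-dart-offset {u} (d , d∈J , e) =
    d , d∈J , [m+n]%o≡p⇒m+n≡p⊎m+n≡p+o (toℕ<n u) (toℕ<n d) e

interval-index : ∀ {k} x → 1 ≤ x → x ≤ k → Fin k
interval-index (suc x) _ x<k = fromℕ< x<k

interval-index-injective : ∀ {k} x y {1≤x x≤k 1≤y y≤k} →
  interval-index {k} x 1≤x x≤k ≡ interval-index y 1≤y y≤k → x ≡ y
interval-index-injective (suc x) (suc y) {x≤k = x<k} {y≤k = y<k} same-index =
  cong suc (trans (sym (toℕ-fromℕ< x<k)) (trans (cong toℕ same-index) (toℕ-fromℕ< y<k)))

interval-outDegree≤ : ∀ n k .{{_ : NonZero n}} → OutDegree≤ (circulant n (interval n k)) k
interval-outDegree≤ n k = record { label = label ; label-injective = label-injective }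
  where
    G = circulant n (interval n k)

    label : ∀ {u w} → Dart G u w → Fin k
    label (d , (1≤d , d≤k) , _) = interval-index (toℕ d) 1≤d d≤k

    label-injective : ∀ {u w w′} (p : Dart G u w) (q : Dart G u w′) → label p ≡ label q → w ≡ w′
    label-injective {u} {w} {w′} (d , _ , u+d≡w) (d′ , _ , u+d′≡w′) same-label =
      toℕ-injective (begin
        toℕ w                 ≡⟨ sym u+d≡w ⟩
        (toℕ u + toℕ d) % n   ≡⟨ cong (λ x → (toℕ u + x) % n) (interval-index-injective _ _ same-label) ⟩
        (toℕ u + toℕ d′) % n  ≡⟨ u+d′≡w′ ⟩
        toℕ w′                ∎)
      where open ≡-Reasoning

module StaircaseColoring (n k : ℕ) .{{_ : NonZero n}} (2k+2≤n : suc k + suc k ≤ n) where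

  G : Digraph
  G = circulant n (interval n k)

  color : ℕ → ℕ
  color i with i ≤? k
  ... | yes _ = i
  ... | no  _ = (i ∸ suc k) ⊓ k

  color≤k : ∀ i → color i ≤ k
  color≤k i with i ≤? k
  ... | yes i≤k = i≤k
  ... | no  _   = m⊓n≤n (i ∸ suc k) k

  color-low : ∀ {i} → i ≤ k → color i ≡ i
  color-low {i} i≤k with i ≤? k
  ... | yes _   = refl
  ... | no  i≰k = contradiction i≤k i≰k

  color-high : ∀ {i} → k < i → color i ≡ (i ∸ suc k) ⊓ k
  color-high {i} k<i with i ≤? k
  ... | yes i≤k = contradiction i≤k (<⇒≱ k<i)
  ... | no  _   = refl

  color-shift : ∀ {b} → b ≤ k → color (suc k + b) ≡ b
  color-shift {b} b≤k = begin
    color (suc k + b)         ≡⟨ color-high (s≤s (m≤m+n k b)) ⟩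
    (suc k + b ∸ suc k) ⊓ k   ≡⟨ cong (_⊓ k) (m+n∸m≡n (suc k) b) ⟩
    b ⊓ k                     ≡⟨ m≤n⇒m⊓n≡m b≤k ⟩
    b                         ∎
    where open ≡-Reasoning

  color-above : ∀ {j i} → j < k → suc k + j < i → j < color i
  color-above {j} {i} j<k k+j<i =
    subst (j <_) (sym (color-high (≤-trans (m≤m+n (suc k) j) (<⇒≤ k+j<i))))
      (⊓-glb (m+n≤o⇒m≤o∸n (suc j) (subst (_≤ i) (cong suc (+-comm (suc k) j)) k+j<i)) j<k)

  wrap-bounds : ∀ {i d j} → i < n → d ≤ k → i + d ≡ j + n → j < k × suc k + j < i
  wrap-bounds {i} {d} {j} i<n d≤k i+d≡j+n = <-≤-trans j<d d≤k , +-cancelʳ-≤ k _ i k+j<i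
    where
      open ≤-Reasoning
      j<d : j < d
      j<d = +-cancelʳ-< n j d (begin-strict
        j + n  ≡⟨ sym i+d≡j+n ⟩
        i + d  <⟨ +-monoˡ-< d i<n ⟩
        n + d  ≡⟨ +-comm n d ⟩
        d + n  ∎)
      rearrange : ∀ k j → suc (suc k + j) + k ≡ j + (suc k + suc k)
      rearrange = solve-∀
      k+j<i : suc (suc k + j) + k ≤ i + k
      k+j<i = begin
        suc (suc k + j) + k  ≡⟨ rearrange k j ⟩
        j + (suc k + suc k)  ≤⟨ +-monoʳ-≤ j 2k+2≤n ⟩
        j + n                ≡⟨ sym i+d≡j+n ⟩
        i + d                ≤⟨ +-monoʳ-≤ i d≤k ⟩
        i + k                ∎

  wrap⇒color-increases : ∀ {i d j} → i < n → d ≤ k → i + d ≡ j + n → color j < color i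
  wrap⇒color-increases i<n d≤k i+d≡j+n with wrap-bounds i<n d≤k i+d≡j+n
  ... | j<k , k+j<i = subst (_< _) (sym (color-low (<⇒≤ j<k))) (color-above j<k k+j<i)

  ς : Fin n → Fin (suc k)
  ς u = fromℕ< (s≤s (color≤k (toℕ u)))

  toℕ-ς : ∀ u → toℕ (ς u) ≡ color (toℕ u)
  toℕ-ς u = toℕ-fromℕ< (s≤s (color≤k (toℕ u)))

  monochromatic-darts-increase : ∀ {u w} → ς u ≡ ς w → Dart G u w → toℕ u < toℕ w
  monochromatic-darts-increase {u} {w} same dart with circulant-dart-offset dart
  ... | d , (1≤d , _)   , inj₁ u+d≡w   = subst (toℕ u <_) u+d≡w (m<m+n (toℕ u) 1≤d)
  ... | d , (_   , d≤k) , inj₂ u+d≡w+n =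
    contradiction (sym same-color) (<⇒≢ (wrap⇒color-increases (toℕ<n u) d≤k u+d≡w+n))
    where
      same-color : color (toℕ u) ≡ color (toℕ w)
      same-color = trans (sym (toℕ-ς u)) (trans (cong toℕ same) (toℕ-ς w))

  toℕ≤k : (a : Fin (suc k)) → toℕ a ≤ k
  toℕ≤k = toℕ≤pred[n]

  low<n : (a : Fin (suc k)) → toℕ a < n
  low<n a = ≤-<-trans (toℕ≤k a) (≤-trans (m≤m+n (suc k) (suc k)) 2k+2≤n)

  high<n : (a : Fin (suc k)) → suc k + toℕ a < n
  high<n a = <-≤-trans (+-monoʳ-< (suc k) (s≤s (toℕ≤k a))) 2k+2≤n

  low high : Fin (suc k) → Fin n
  low  a = fromℕ< (low<n a)
  high a = fromℕ< (high<n a)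

  ς-low : ∀ a → ς (low a) ≡ a
  ς-low a = toℕ-injective (begin
    toℕ (ς (low a))      ≡⟨ toℕ-ς (low a) ⟩
    color (toℕ (low a))  ≡⟨ cong color (toℕ-fromℕ< (low<n a)) ⟩
    color (toℕ a)        ≡⟨ color-low (toℕ≤k a) ⟩
    toℕ a                ∎)
    where open ≡-Reasoning

  ς-high : ∀ a → ς (high a) ≡ a
  ς-high a = toℕ-injective (begin
    toℕ (ς (high a))      ≡⟨ toℕ-ς (high a) ⟩
    color (toℕ (high a))  ≡⟨ cong color (toℕ-fromℕ< (high<n a)) ⟩
    color (suc k + toℕ a) ≡⟨ color-shift (toℕ≤k a) ⟩
    toℕ a                 ∎)
    where open ≡-Reasoning

  forward-dart : ∀ {i j} (i<n : i < n) (j<n : j < n) → i < j → j ≤ i + k →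
    Dart G (fromℕ< i<n) (fromℕ< j<n)
  forward-dart {i} {j} i<n j<n i<j j≤i+k =
    circulant-dart d (subst (1 ≤_) (sym toℕ-d) (m<n⇒0<n∸m i<j) ,
                      subst (_≤ k) (sym toℕ-d) (m≤n+o⇒m∸n≤o j i j≤i+k)) (begin
      toℕ (fromℕ< i<n) + toℕ d  ≡⟨ cong₂ _+_ (toℕ-fromℕ< i<n) toℕ-d ⟩
      i + (j ∸ i)               ≡⟨ m+[n∸m]≡n (<⇒≤ i<j) ⟩
      j                         ≡⟨ sym (toℕ-fromℕ< j<n) ⟩
      toℕ (fromℕ< j<n)          ∎)
    where
      open ≡-Reasoning
      j∸i<n : j ∸ i < n
      j∸i<n = ≤-<-trans (m∸n≤m j i) j<n
      d : Fin n
      d = fromℕ< j∸i<n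
      toℕ-d : toℕ d ≡ j ∸ i
      toℕ-d = toℕ-fromℕ< j∸i<n

  low→low : ∀ {a b} → toℕ a < toℕ b → Dart G (low a) (low b)
  low→low {a} {b} a<b = forward-dart (low<n a) (low<n b) a<b (≤-trans (toℕ≤k b) (m≤n+m k (toℕ a)))

  low→high : ∀ {a b} → toℕ b < toℕ a → Dart G (low a) (high b)
  low→high {a} {b} b<a = forward-dart (low<n a) (high<n b)
    (s≤s (≤-trans (toℕ≤k a) (m≤m+n k (toℕ b)))) (begin
    suc k + toℕ b    ≡⟨ sym (+-suc k (toℕ b)) ⟩
    k + suc (toℕ b)  ≤⟨ +-monoʳ-≤ k b<a ⟩
    k + toℕ a        ≡⟨ +-comm k (toℕ a) ⟩
    toℕ a + k        ∎)
    where open ≤-Reasoning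

  high→high : ∀ {a b} → toℕ a < toℕ b → Dart G (high a) (high b)
  high→high {a} {b} a<b = forward-dart (high<n a) (high<n b) (+-monoʳ-< (suc k) a<b) (begin
    suc k + toℕ b          ≤⟨ +-monoʳ-≤ (suc k) (≤-trans (toℕ≤k b) (m≤n+m k (toℕ a))) ⟩
    suc k + (toℕ a + k)    ≡⟨ sym (+-assoc (suc k) (toℕ a) k) ⟩
    suc k + toℕ a + k      ∎)
    where open ≤-Reasoning

  low-isB⁺ : ∀ a → IsB⁺ G ς (low a)
  low-isB⁺ a b b≢a with <-cmp (toℕ b) (toℕ a)
  ... | tri< b<a _ _ = high b , low→high b<a , ς-high b
  ... | tri≈ _ b≡a _ = contradiction (trans (toℕ-injective b≡a) (sym (ς-low a))) b≢a
  ... | tri> _ _ a<b = low b , low→low a<b , ς-low b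

  high-isB⁻ : ∀ a → IsB⁻ G ς (high a)
  high-isB⁻ a b b≢a with <-cmp (toℕ b) (toℕ a)
  ... | tri< b<a _ _ = high b , high→high b<a , ς-high b
  ... | tri≈ _ b≡a _ = contradiction (trans (toℕ-injective b≡a) (sym (ς-high a))) b≢a
  ... | tri> _ _ a<b = low b , low→high a<b , ς-low b

  isBColoring : IsBColoring G (suc k) ς
  isBColoring = (λ a → low a , λ { refl → ς-low a })
              , (λ a → low a , ς-low a , low-isB⁺ a)
              , (λ a → high a , ς-high a , high-isB⁻ a)

  isAcyclic : IsAcyclic G ς
  isAcyclic = monochromatic-darts-increase⇒acyclic G ς monochromatic-darts-increase

≤[n∸2]/2⇒2+2k≤n : ∀ {n k} → 2 ≤ n → k ≤ (n ∸ 2) / 2 → suc k + suc k ≤ n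
≤[n∸2]/2⇒2+2k≤n {n} {k} 2≤n k≤[n∸2]/2 = begin
  suc k + suc k  ≡⟨ double k ⟩
  2 + k * 2      ≤⟨ +-monoʳ-≤ 2 (≤-trans (*-monoˡ-≤ 2 k≤[n∸2]/2) (m/n*n≤m (n ∸ 2) 2)) ⟩
  2 + (n ∸ 2)    ≡⟨ m+[n∸m]≡n 2≤n ⟩
  n              ∎
  where
    open ≤-Reasoning
    double : ∀ k → suc k + suc k ≡ 2 + k * 2
    double = solve-∀

corollary10 : (n k : ℕ) → .{{_ : NonZero n}} → 4 ≤ n → 1 ≤ k → k ≤ (n ∸ 2) / 2 →
                  DibIs (circulant n (interval n k)) (suc k)
corollary10 n k 4≤n _ k≤[n∸2]/2 =
  (ς , isBColoring , isAcyclic) ,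
  λ _ (_ , isBColoring′ , _) → bColoring⇒colors≤1+outdegree (interval-outDegree≤ n k) isBColoring′
  where
    open StaircaseColoring n k (≤[n∸2]/2⇒2+2k≤n (≤-trans (s≤s (s≤s z≤n)) 4≤n) k≤[n∸2]/2)
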